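{- Let $G=(V,E)$ be a directed acyclic graph and let $K\subseteq V$ have local relationships. Then for all distinct $v_1,v_2\in K$, either $v_1$ and $v_2$ are connected in $K$ (joined by a path in the undirected graph underlying the subgraph of $G$ induced by $K$), or $v_1$ and $v_2$ are d-separated by the empty set (every trail between $v_1$ and $v_2$ contains a converging connection).
   Context: A trail is a sequence of pairwise distinct nodes with consecutive nodes adjacent (arc in either direction), written $v_1\sim\cdots\sim v_n$. An interior node $v_j$ is a converging connection if $v_{j-1}\to v_j\leftarrow v_{j+1}$. A set $K\subseteq V$ has local relationships if for all $v_1,v_2\in K$ such that there is a trail $v_1\sim x_1\sim\cdots\sim x_n\sim v_2$ with no converging connection and all $x_i\notin K$, the nodes $v_1,v_2$ are adjacent. -}

module Defs where

open import Data.Nat using (ℕ)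
open import Data.Fin using (Fin)
open import Data.Fin.Subset using (Subset; _∈_; _∉_)
open import Data.List using (List; []; _∷_; _++_; [_])
open import Data.List.Relation.Unary.All using (All)
open import Data.List.Relation.Unary.Linked using (Linked)
open import Data.List.Relation.Unary.Unique.Propositional using (Unique)
open import Data.Product using (Σ; _×_; ∃)
open import Data.Sum using (_⊎_)
open import Relation.Nullary using (¬_)
open import Relation.Binary using (Rel; Decidable)

-- A directed graph on the finite node set Fin n: E u v means there is an arc u → v.
Digraph : ℕ → Set₁
Digraph n = Rel (Fin n) _

module _ {n : ℕ} (E : Digraph n) where

  Adj : Fin n → Fin n → Set
  Adj u v = E u v ⊎ E v u

  Acyclic : Set
  Acyclic = ¬ (Σ (Fin n) λ v → Σ (List (Fin n)) λ xs → Linked E (v ∷ xs ++ [ v ]))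

  nodes : Fin n → List (Fin n) → Fin n → List (Fin n)
  nodes u xs w = u ∷ xs ++ [ w ]

  IsTrail : Fin n → List (Fin n) → Fin n → Set
  IsTrail u xs w = Unique (nodes u xs w) × Linked Adj (nodes u xs w)

  data HasConverging : List (Fin n) → Set where
    here  : ∀ {a b c xs} → E a b → E c b → HasConverging (a ∷ b ∷ c ∷ xs)
    there : ∀ {x xs} → HasConverging xs → HasConverging (x ∷ xs)

  LocalRelationships : Subset n → Set
  LocalRelationships K =
    ∀ v₁ v₂ → v₁ ∈ K → v₂ ∈ K →
    ∀ xs → IsTrail v₁ xs v₂ → ¬ HasConverging (nodes v₁ xs v₂) → All (_∉ K) xs →
    Adj v₁ v₂

  ConnectedIn : Subset n → Fin n → Fin n → Set
  ConnectedIn K v₁ v₂ =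
    Σ (List (Fin n)) λ xs → IsTrail v₁ xs v₂ × All (_∈ K) (nodes v₁ xs v₂)

  DSeparatedByEmpty : Fin n → Fin n → Set
  DSeparatedByEmpty v₁ v₂ =
    ∀ xs → IsTrail v₁ xs v₂ → HasConverging (nodes v₁ xs v₂)

{-# OPTIONS --safe #-}
-- Walking along a trail without converging connections from v₁ to v₂, any two
-- consecutive members of K are joined by a sub-trail whose interior avoids K; it
-- still has no converging connection, so local relationships make them adjacent.
-- Hence the members of K on the trail form a trail inside K.  Trails have at most
-- n interior nodes, so whether such a trail exists is decidable, and if none
-- exists every trail has a converging connection.
module Submission where

open import Defs
open import Level using (0ℓ)
open import Data.Nat as ℕ using (ℕ; _≤_; z≤n; s≤s)
open import Data.Fin using (Fin; _≟_; zero; suc)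
open import Data.Fin.Properties using (any?; injective⇒≤)
open import Data.Fin.Subset using (Subset; _∈_; _∉_)
open import Data.Fin.Subset.Properties using (_∈?_)
open import Data.List using (List; []; _∷_; _++_; [_]; length; lookup; filter)
open import Data.List.Properties using (++-assoc; filter-accept; filter-++)
open import Data.List.Membership.Propositional.Properties using (∈-lookup)
open import Data.List.Relation.Unary.All as All using (All; []; _∷_)
import Data.List.Relation.Unary.All.Properties as All
open import Data.List.Relation.Unary.AllPairs using (AllPairs; []; _∷_)
open import Data.List.Relation.Unary.Linked as Linked using (Linked; []; [-]; _∷_; linked?)
open import Data.List.Relation.Unary.Unique.Propositional using (Unique)
import Data.List.Relation.Unary.Unique.Propositional.Properties as Unique
import Data.List.Relation.Unary.Unique.DecPropositional as UniqueDec
open import Data.Product using (∃; _×_; _,_; uncurry)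
open import Data.Sum using (_⊎_; inj₁; inj₂; [_,_]′)
open import Function using (_∘_)
open import Relation.Nullary using (¬_; Dec; yes; no; contradiction; ¬?)
open import Relation.Nullary.Decidable using (_×-dec_; _⊎-dec_; map′; decidable-stable)
open import Relation.Binary using (Rel; Decidable)
open import Relation.Binary.PropositionalEquality using (_≡_; refl; sym; cong; subst; module ≡-Reasoning)
open import Relation.Unary using (Pred) renaming (Decidable to Decidable₁)

module _ {A : Set} {R : Rel A 0ℓ} where

  AllPairs-++⁻ˡ : ∀ xs {ys} → AllPairs R (xs ++ ys) → AllPairs R xs
  AllPairs-++⁻ˡ []       _        = []
  AllPairs-++⁻ˡ (x ∷ xs) (px ∷ p) = All.++⁻ˡ xs px ∷ AllPairs-++⁻ˡ xs p

  AllPairs-++⁻ʳ : ∀ xs {ys} → AllPairs R (xs ++ ys) → AllPairs R ys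
  AllPairs-++⁻ʳ []       p       = p
  AllPairs-++⁻ʳ (x ∷ xs) (_ ∷ p) = AllPairs-++⁻ʳ xs p

  Linked-++⁻ˡ : ∀ xs {ys} → Linked R (xs ++ ys) → Linked R xs
  Linked-++⁻ˡ []           _       = []
  Linked-++⁻ˡ (x ∷ [])     _       = [-]
  Linked-++⁻ˡ (x ∷ y ∷ xs) (r ∷ l) = r ∷ Linked-++⁻ˡ (y ∷ xs) l

  Linked-++⁻ʳ : ∀ xs {ys} → Linked R (xs ++ ys) → Linked R ys
  Linked-++⁻ʳ []       l = l
  Linked-++⁻ʳ (x ∷ xs) l = Linked-++⁻ʳ xs (Linked.tail l)

module _ {A : Set} {P : Pred A 0ℓ} (P? : Decidable₁ P) where

  filter-between : ∀ {u w} xs → P u → P w →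
                   filter P? (u ∷ xs ++ [ w ]) ≡ u ∷ filter P? xs ++ [ w ]
  filter-between {u} {w} xs Pu Pw = begin
    filter P? (u ∷ xs ++ [ w ])             ≡⟨ filter-accept P? Pu ⟩
    u ∷ filter P? (xs ++ [ w ])             ≡⟨ cong (u ∷_) (filter-++ P? xs [ w ]) ⟩
    u ∷ filter P? xs ++ filter P? [ w ]     ≡⟨ cong (λ ws → u ∷ filter P? xs ++ ws) (filter-accept P? Pw) ⟩
    u ∷ filter P? xs ++ [ w ]               ∎
    where open ≡-Reasoning

Unique⇒lookup-injective : ∀ {A : Set} {xs : List A} → Unique xs →
                          ∀ {i j} → lookup xs i ≡ lookup xs j → i ≡ j
Unique⇒lookup-injective (_ ∷ _)    {zero}  {zero}  _  = refl
Unique⇒lookup-injective (x∉xs ∷ _) {zero}  {suc j} eq = contradiction eq (All.lookup x∉xs (∈-lookup j))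
Unique⇒lookup-injective (x∉xs ∷ _) {suc i} {zero}  eq = contradiction (sym eq) (All.lookup x∉xs (∈-lookup i))
Unique⇒lookup-injective (_ ∷ xs!)  {suc i} {suc j} eq = cong suc (Unique⇒lookup-injective xs! eq)

Unique⇒length≤ : ∀ {n} {xs : List (Fin n)} → Unique xs → length xs ≤ n
Unique⇒length≤ xs! = injective⇒≤ (Unique⇒lookup-injective xs!)

∃-length≤? : ∀ {n} {P : Pred (List (Fin n)) 0ℓ} → Decidable₁ P →
             ∀ m → Dec (∃ λ xs → length xs ≤ m × P xs)
∃-length≤? P? ℕ.zero with P? []
... | yes p = yes ([] , z≤n , p)
... | no ¬p = no λ { ([] , _ , p) → ¬p p ; (_ ∷ _ , () , _) }
∃-length≤? P? (ℕ.suc m) with P? [] | any? (λ x → ∃-length≤? (P? ∘ (x ∷_)) m)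
... | yes p | _                      = yes ([] , z≤n , p)
... | no _  | yes (x , xs , ≤m , p) = yes (x ∷ xs , s≤s ≤m , p)
... | no ¬p | no ¬q                  =
  no λ { ([] , _ , p) → ¬p p ; (x ∷ xs , s≤s ≤m , p) → ¬q (x , xs , ≤m , p) }

module _ {n : ℕ} (E : Digraph n) where

  HasConverging-++⁺ˡ : ∀ {xs} ys → HasConverging E xs → HasConverging E (xs ++ ys)
  HasConverging-++⁺ˡ ys (here p q) = here p q
  HasConverging-++⁺ˡ ys (there h)  = there (HasConverging-++⁺ˡ ys h)

  HasConverging-++⁺ʳ : ∀ xs {ys} → HasConverging E ys → HasConverging E (xs ++ ys)
  HasConverging-++⁺ʳ []       h = h
  HasConverging-++⁺ʳ (x ∷ xs) h = there (HasConverging-++⁺ʳ xs h)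

  hasConverging? : Decidable E → Decidable₁ (HasConverging E)
  hasConverging? E? []            = no λ ()
  hasConverging? E? (_ ∷ [])      = no λ { (there ()) }
  hasConverging? E? (_ ∷ _ ∷ [])  = no λ { (there (there ())) }
  hasConverging? E? (a ∷ b ∷ c ∷ vs) =
    map′ [ uncurry here , there ]′ (λ { (here p q) → inj₁ (p , q) ; (there h) → inj₂ h })
         ((E? a b ×-dec E? c b) ⊎-dec hasConverging? E? (b ∷ c ∷ vs))

  ActiveTrail : List (Fin n) → Set
  ActiveTrail vs = (Unique vs × Linked (Adj E) vs) × ¬ HasConverging E vs

  ActiveTrail-++⁻ˡ : ∀ xs {ys} → ActiveTrail (xs ++ ys) → ActiveTrail xs
  ActiveTrail-++⁻ˡ xs ((xs! , linked) , ¬hc) =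
    (AllPairs-++⁻ˡ xs xs! , Linked-++⁻ˡ xs linked) , ¬hc ∘ HasConverging-++⁺ˡ _

  ActiveTrail-++⁻ʳ : ∀ xs {ys} → ActiveTrail (xs ++ ys) → ActiveTrail ys
  ActiveTrail-++⁻ʳ xs ((xs! , linked) , ¬hc) =
    (AllPairs-++⁻ʳ xs xs! , Linked-++⁻ʳ xs linked) , ¬hc ∘ HasConverging-++⁺ʳ xs

  activeTrail? : Decidable E → Decidable₁ ActiveTrail
  activeTrail? E? vs =
    (UniqueDec.unique? _≟_ vs ×-dec linked? (λ u v → E? u v ⊎-dec E? v u) vs) ×-dec ¬? (hasConverging? E? vs)

  activeTrailBetween? : Decidable E → ∀ u w → Dec (∃ λ xs → ActiveTrail (nodes E u xs w))
  activeTrailBetween? E? u w =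
    map′ (λ (xs , _ , active) → xs , active)
         (λ (xs , active) → xs , interior-length≤ xs active , active)
         (∃-length≤? (λ xs → activeTrail? E? (nodes E u xs w)) n)
    where
    interior-length≤ : ∀ xs → ActiveTrail (nodes E u xs w) → length xs ≤ n
    interior-length≤ xs (((_ ∷ xs!) , _) , _) = Unique⇒length≤ (AllPairs-++⁻ˡ xs xs!)

  module _ (K : Subset n) (local : LocalRelationships E K) where

    local⇒adjacent : ∀ {a b} qs → a ∈ K → b ∈ K → All (_∉ K) qs → ActiveTrail (a ∷ qs ++ [ b ]) → Adj E a b
    local⇒adjacent qs a∈K b∈K qs∉K (trail , ¬hc) = local _ _ a∈K b∈K qs trail ¬hc qs∉K

    -- qs is the run of nodes outside K seen since the last member a of K.
    linked-filter : ∀ {a b} qs ps → a ∈ K → b ∈ K → All (_∉ K) qs →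
                    ActiveTrail (a ∷ qs ++ ps ++ [ b ]) →
                    Linked (Adj E) (a ∷ filter (_∈? K) ps ++ [ b ])
    linked-filter qs [] a∈K b∈K qs∉K active = local⇒adjacent qs a∈K b∈K qs∉K active ∷ [-]
    linked-filter {a} {b} qs (x ∷ ps) a∈K b∈K qs∉K active
      with active′ ← subst (λ vs → ActiveTrail (a ∷ vs)) (sym (++-assoc qs [ x ] (ps ++ [ b ]))) active
      with x ∈? K
    ... | no x∉K = linked-filter (qs ++ [ x ]) ps a∈K b∈K (All.++⁺ qs∉K (x∉K ∷ [])) active′
    ... | yes x∈K =
      local⇒adjacent qs a∈K x∈K qs∉K (ActiveTrail-++⁻ˡ (a ∷ qs ++ [ x ]) active′) ∷
      linked-filter [] ps x∈K b∈K [] (ActiveTrail-++⁻ʳ (a ∷ qs) active)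

    active⇒connectedIn : ∀ {u w} xs → u ∈ K → w ∈ K → ActiveTrail (nodes E u xs w) → ConnectedIn E K u w
    active⇒connectedIn xs u∈K w∈K active@((nodes! , _) , _) =
      filter (_∈? K) xs ,
      ( subst Unique (filter-between (_∈? K) xs u∈K w∈K) (Unique.filter⁺ (_∈? K) nodes!)
      , linked-filter [] xs u∈K w∈K [] active) ,
      u∈K ∷ All.++⁺ (All.all-filter (_∈? K) xs) (w∈K ∷ [])

corollary5p5 : ∀ {n : ℕ} (E : Digraph n) → Decidable E → Acyclic E →
    (K : Subset n) → LocalRelationships E K →
    ∀ v₁ v₂ → v₁ ∈ K → v₂ ∈ K → ¬ v₁ ≡ v₂ →
    ConnectedIn E K v₁ v₂ ⊎ DSeparatedByEmpty E v₁ v₂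
corollary5p5 E E? _ K local v₁ v₂ v₁∈K v₂∈K _ with activeTrailBetween? E E? v₁ v₂
... | yes (xs , active) = inj₁ (active⇒connectedIn E K local xs v₁∈K v₂∈K active)
... | no ¬active        = inj₂ λ xs trail →
  decidable-stable (hasConverging? E E? (nodes E v₁ xs v₂)) λ ¬hc → ¬active (xs , trail , ¬hc)
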